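{- Let $C$ be a command, $P,Q$ assertions, $\Gamma$ a resource context and $A\subseteq\mathbf{Var}$. If for every $(s,h)\in\mathcal{S}$ with $s,h\models P$ and every $n\ge0$ the predicate $\mathit{Safe}_n(C,s,h,(\emptyset,\emptyset,Res(\Gamma)),\Gamma,Q,A)$ holds, then $\Gamma\models\{P\}C\{Q\}$.
   Context: States and assertions. $\mathbf{Var}$ variables, $\mathbf{Val}$ values (integers and $null$), $\mathbf{Loc}\subseteq\mathbb{N}$ locations; stores $s:\mathbf{Var}\to\mathbf{Val}$, heaps finite partial $h:\mathbf{Loc}\rightharpoonup\mathbf{Val}$; $\mathcal{S}$ the set of pairs $(s,h)$. Assertions are those of separation logic (built from boolean expressions, $\neg,\wedge,\forall$, $\texttt{emp}$, $e\mapsto e'$, $\ast$) with the standard satisfaction $s,h\models P$. $h\bot g$: disjoint domains; $h\uplus g$: their union. $\mathbf{Res}$ is a set of resource names disjoint from $\mathbf{Var}$. A resource context $\Gamma$ is a list $r_1(X_1):R_1,\dots,r_n(X_n):R_n$ of distinct $r_i\in\mathbf{Res}$, $X_i\subseteq\mathbf{Var}$, precise assertions $R_i$ with $FV(R_i)\subseteq X_i$ (precise: for each $(s,h)$ at most one subheap satisfies it); $Res(\Gamma)$, $PV(r_i)=X_i$, $PV(\Gamma)=\bigcup X_i$, $\Gamma(r_i)=R_i$; for $D\subseteq Res(\Gamma)$, $\circledast_{r\in D}\Gamma(r)$ is the separating conjunction of the $\Gamma(r)$, $r\in D$ ($\texttt{emp}$ if $D=\emptyset$), and $inv(\Gamma)=\circledast_{r\in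 Res(\Gamma)}\Gamma(r)$. Commands: $\mathsf{skip}$, basic commands $x:=e$, $x:=[e]$, $[e]:=e'$, $x:=\mathsf{cons}(e_1,\dots,e_n)$, $\mathsf{dispose}(e)$, sequencing, conditionals, while loops, $\mathsf{resource}\ r\ \mathsf{in}\ C$, $\mathsf{with}\ r\ \mathsf{when}\ B\ \mathsf{do}\ C$, $C_1\|C_2$, and (extended) $\mathsf{within}\ r\ \mathsf{do}\ C$. $Locked(C_1;C_2)=Locked(C_1)$, $Locked(C_1\|C_2)=Locked(C_1)\cup Locked(C_2)$, $Locked(\mathsf{resource}\ r\ \mathsf{in}\ C)=Locked(C)\setminus\{r\}$, $Locked(\mathsf{within}\ r\ \mathsf{do}\ C)=Locked(C)\cup\{r\}$, else $\emptyset$. A resource configuration is a triple $\rho=(O,L,D)$ of pairwise disjoint subsets of $\mathbf{Res}$. The program transition relation $\to_p$ (between $(C,(s,h,\rho))$ and $(C',(s',h',\rho'))$ or $\mathsf{abort}$) is the structural operational semantics with rules: (S1) $\mathsf{skip};C_2\to C_2$; (S2) $C_1;C_2$ steps as $C_1$; (LP) while unfolds to $\mathsf{if}\ B\ \mathsf{then}\ (C;\mathsf{while}\ B\ \mathsf{do}\ C)\ \mathsf{else}\ \mathsf{skip}$; (IF1/IF2) conditional by $s(B)$; (P1/P2) either parallel component steps; (P3) $\mathsf{skip}\|\mathsf{skip}\to\mathsf{skip}$; (R0) $\mathsf{resource}\ r\ \mathsf{in}\ \mathsf{skip}\to\mathsf{skip}$ if $r\notin O\cup L\cup D$; (R1)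 if $r\notin\rho=(O,L,D)$, $r\in Locked(C)$ and $C,(s,h,(O\cup\{r\},L,D))\to_pC',(s',h',\rho')$ then $\mathsf{resource}\ r\ \mathsf{in}\ C,(s,h,\rho)\to_p\mathsf{resource}\ r\ \mathsf{in}\ C',(s',h',\rho'\setminus\{r\})$ (removing $r$ from all components); (R2) same with $r\notin Locked(C)$ and $(O,L,D\cup\{r\})$; (W0) $\mathsf{with}\ r\ \mathsf{when}\ B\ \mathsf{do}\ C,(s,h,(O,L,D\cup\{r\}))\to_p\mathsf{within}\ r\ \mathsf{do}\ C,(s,h,(O\cup\{r\},L,D))$ if $s(B)=\texttt{true}$; (W1) if $r\in O$ and $C,(s,h,(O\setminus\{r\},L,D))\to_pC',(s',h',(O',L',D'))$ then $\mathsf{within}\ r\ \mathsf{do}\ C,(s,h,(O,L,D))\to_p\mathsf{within}\ r\ \mathsf{do}\ C',(s',h',(O'\cup\{r\},L',D'))$; (W2) $\mathsf{within}\ r\ \mathsf{do}\ \mathsf{skip},(s,h,(O\cup\{r\},L,D))\to_p\mathsf{skip},(s,h,(O,L,D\cup\{r\}))$; (BCT) a basic command $c$ steps to $\mathsf{skip}$ with $(s',h')$ a result of its standard heap semantics $[c](s,h)$, $\rho$ unchanged. Abort: resource declaration of an existing $r\in\rho$; $\mathsf{with}$ on $r\notin\rho$; $\mathsf{within}\ r$ with $r\notin O$; basic-command memory fault; and propagation through $;$ (first component), $\|$ (either component), $\mathsf{resource}$ (rules (RA1)/(RA2) with the same configurations as (R1)/(R2)) and $\mathsf{within}\ r\ \mathsf{do}\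 C$ (if $C$ aborts from $\rho\setminus\{r\}$). $\to_p^k$ is the $k$-fold composition. Validity: $\Gamma\models\{P\}C\{Q\}$ iff for every $(s,h)$ with $s,h\models P\ast inv(\Gamma)$: $C,(s,h,(\emptyset,\emptyset,Res(\Gamma)))\not\to_p^k\mathsf{abort}$ for all $k\ge0$, and whenever $C,(s,h,(\emptyset,\emptyset,Res(\Gamma)))\to_p^k\mathsf{skip},(s',h',(\emptyset,\emptyset,Res(\Gamma)))$ then $s',h'\models Q\ast inv(\Gamma)$. Environment: for $A\subseteq\mathbf{Var}$, $(s,h,(O,L,D))\stackrel{A}{\leftrightsquigarrow}(s',h,(O,L',D'))$ iff $s(x)=s'(x)$ for all $x\in A$ and $L'\cup D'=L\cup D$. The environment transition $\xrightarrow{A,\Gamma}_e$: with $A'=A\cup\bigcup_{r\in Locked(C)}PV(r)$, if $(s,h,\rho)\stackrel{A'}{\leftrightsquigarrow}(s',h,\rho')$, $\rho=(O,L,D)$, $\rho'=(O,L',D')$, $s,h_G\models\circledast_{r\in D}\Gamma(r)$ and $s',h'_G\models\circledast_{r\in D'}\Gamma(r)$ (with $h_G,h'_G$ disjoint from $h$), then $C,(s,h\uplus h_G,\rho)\xrightarrow{A,\Gamma}_eC,(s',h\uplus h'_G,\rho')$. $\xrightarrow{A,\Gamma}=\to_p\cup\xrightarrow{A,\Gamma}_e$. $chng(C)$ is the set of variables $x$ such that the next transition of $C$ can execute $x:=e$, $x:=[e]$ or $x:=\mathsf{cons}(\dots)$. Safety: $\mathit{Safe}_0(C,s,h,\rho,\Gamma,Q,A)$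 always holds; $\mathit{Safe}_{n+1}(C,s,h,\rho,\Gamma,Q,A)$ with $\rho=(O,L,D)$ holds iff (i) if $C=\mathsf{skip}$ then $s,h\models Q$; (ii) $C,(s,h,\rho)\not\to_p\mathsf{abort}$; (iii) $chng(C)\cap\bigcup_{r\in L\cup D}PV(r)=\emptyset$; (iv) for every $h_G$ with $h\bot h_G$ and $s,h_G\models\circledast_{r\in D}\Gamma(r)$ and every $C,(s,h\uplus h_G,\rho)\xrightarrow{A,\Gamma}C',(s',\hat h,\rho')$ with $\rho'=(O',L',D')$, there exist $h',h'_G$ with $\hat h=h'\uplus h'_G$, $s',h'_G\models\circledast_{r\in D'}\Gamma(r)$ and $\mathit{Safe}_n(C',s',h',\rho',\Gamma,Q,A)$. -}

module Defs where

open import Data.Nat as ℕ using (ℕ; zero; suc; _≡ᵇ_)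
open import Data.Integer as ℤ using (ℤ)
open import Data.Bool using (Bool; true; false; if_then_else_; _∧_; _∨_; not)
open import Data.Maybe using (Maybe; just; nothing)
open import Data.List using (List; []; _∷_; foldr; map)
open import Data.Bool.ListAction using (any)
open import Data.Product using (Σ; ∃; _×_; _,_)
open import Data.Sum using (_⊎_)
open import Data.Empty using (⊥)
open import Data.Unit using (⊤)
open import Relation.Nullary using (¬_)
open import Relation.Binary.PropositionalEquality using (_≡_; _≢_)

Var : Set
Var = ℕ

Res : Set
Res = ℕ

Loc : Set
Loc = ℕ

-- values: integers and null; location l is the integer value (+ l)
data Val : Set where
  int  : ℤ → Val
  null : Val

Store : Set
Store = Var → Val

record Heap : Set where
  constructor mkHeap
  field
    fun    : Loc → Maybe Val
    finite : Σ ℕ λ b → ∀ l → b ℕ.≤ l → fun l ≡ nothing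
open Heap public

-- disjoint union:  Sep h₁ h₂ h  means  h₁ ⊥ h₂  and  h = h₁ ⊎ h₂
Sep : Heap → Heap → Heap → Set
Sep h₁ h₂ h = ∀ l → (fun h₁ l ≡ nothing × fun h l ≡ fun h₂ l)
                  ⊎ (fun h₂ l ≡ nothing × fun h l ≡ fun h₁ l)

_⊑_ : Heap → Heap → Set
h₁ ⊑ h = ∀ l v → fun h₁ l ≡ just v → fun h l ≡ just v

_≈ₕ_ : Heap → Heap → Set
h₁ ≈ₕ h₂ = ∀ l → fun h₁ l ≡ fun h₂ l

_[_≔_] : Store → Var → Val → Store
(s [ x ≔ v ]) y = if y ≡ᵇ x then v else s y

data Exp : Set where
  var  : Var → Exp
  lit  : Val → Exp
  plus minus times : Exp → Exp → Exp

data BExp : Set where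
  btrue bfalse : BExp
  eq leq : Exp → Exp → BExp
  bnot : BExp → BExp
  band : BExp → BExp → BExp

-- convention: arithmetic involving null yields null
arith : (ℤ → ℤ → ℤ) → Val → Val → Val
arith f (int m) (int n) = int (f m n)
arith f _ _ = null

⟦_⟧ₑ : Exp → Store → Val
⟦ var x ⟧ₑ s = s x
⟦ lit v ⟧ₑ s = v
⟦ plus e e' ⟧ₑ s = arith ℤ._+_ (⟦ e ⟧ₑ s) (⟦ e' ⟧ₑ s)
⟦ minus e e' ⟧ₑ s = arith ℤ._-_ (⟦ e ⟧ₑ s) (⟦ e' ⟧ₑ s)
⟦ times e e' ⟧ₑ s = arith ℤ._*_ (⟦ e ⟧ₑ s) (⟦ e' ⟧ₑ s)

valEq : Val → Val → Bool
valEq (int m) (int n) = Relation.Nullary.does (m ℤ.≟ n)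
  where import Relation.Nullary
valEq null null = true
valEq _ _ = false

valLeq : Val → Val → Bool
valLeq (int m) (int n) = Relation.Nullary.does (m ℤ.≤? n)
  where import Relation.Nullary
valLeq _ _ = false

⟦_⟧ᵇ : BExp → Store → Bool
⟦ btrue ⟧ᵇ s = true
⟦ bfalse ⟧ᵇ s = false
⟦ eq e e' ⟧ᵇ s = valEq (⟦ e ⟧ₑ s) (⟦ e' ⟧ₑ s)
⟦ leq e e' ⟧ᵇ s = valLeq (⟦ e ⟧ₑ s) (⟦ e' ⟧ₑ s)
⟦ bnot b ⟧ᵇ s = not (⟦ b ⟧ᵇ s)
⟦ band b b' ⟧ᵇ s = ⟦ b ⟧ᵇ s ∧ ⟦ b' ⟧ᵇ s

FreeE : Var → Exp → Set
FreeE x (var y) = x ≡ y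
FreeE x (lit v) = ⊥
FreeE x (plus e e') = FreeE x e ⊎ FreeE x e'
FreeE x (minus e e') = FreeE x e ⊎ FreeE x e'
FreeE x (times e e') = FreeE x e ⊎ FreeE x e'

FreeB : Var → BExp → Set
FreeB x btrue = ⊥
FreeB x bfalse = ⊥
FreeB x (eq e e') = FreeE x e ⊎ FreeE x e'
FreeB x (leq e e') = FreeE x e ⊎ FreeE x e'
FreeB x (bnot b) = FreeB x b
FreeB x (band b b') = FreeB x b ⊎ FreeB x b'

data Assn : Set where
  bool  : BExp → Assn
  neg   : Assn → Assn
  conj  : Assn → Assn → Assn
  all   : Var → Assn → Assn
  emp   : Assn
  _↦_   : Exp → Exp → Assn
  _⋆_   : Assn → Assn → Assn

_,_⊨_ : Store → Heap → Assn → Set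
s , h ⊨ bool b = ⟦ b ⟧ᵇ s ≡ true
s , h ⊨ neg P = ¬ (s , h ⊨ P)
s , h ⊨ conj P Q = (s , h ⊨ P) × (s , h ⊨ Q)
s , h ⊨ all x P = ∀ v → (s [ x ≔ v ]) , h ⊨ P
s , h ⊨ emp = ∀ l → fun h l ≡ nothing
s , h ⊨ (e ↦ e') = Σ Loc λ l → (⟦ e ⟧ₑ s ≡ int (ℤ.+ l))
                     × (∀ l' → fun h l' ≡ (if l' ≡ᵇ l then just (⟦ e' ⟧ₑ s) else nothing))
s , h ⊨ (P ⋆ Q) = Σ Heap λ h₁ → Σ Heap λ h₂ → Sep h₁ h₂ h × (s , h₁ ⊨ P) × (s , h₂ ⊨ Q)

FreeA : Var → Assn → Set
FreeA x (bool b) = FreeB x b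
FreeA x (neg P) = FreeA x P
FreeA x (conj P Q) = FreeA x P ⊎ FreeA x Q
FreeA x (all y P) = x ≢ y × FreeA x P
FreeA x emp = ⊥
FreeA x (e ↦ e') = FreeE x e ⊎ FreeE x e'
FreeA x (P ⋆ Q) = FreeA x P ⊎ FreeA x Q

Precise : Assn → Set
Precise R = ∀ s h h₁ h₂ → h₁ ⊑ h → h₂ ⊑ h → s , h₁ ⊨ R → s , h₂ ⊨ R → h₁ ≈ₕ h₂

record Entry : Set₁ where
  constructor _⟨_⟩∶_
  field
    name : Res
    pv   : Var → Set
    rinv : Assn
open Entry public

Ctx : Set₁
Ctx = List Entry

WFCtx : Ctx → Set
WFCtx [] = ⊤
WFCtx (e ∷ Γ) = NotIn (name e) Γ × Precise (rinv e) × (∀ x → FreeA x (rinv e) → pv e x)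
              × WFCtx Γ
  where
  NotIn : Res → Ctx → Set
  NotIn r [] = ⊤
  NotIn r (e' ∷ Γ') = r ≢ name e' × NotIn r Γ'

inv : Ctx → Assn
inv Γ = foldr (λ e acc → rinv e ⋆ acc) emp Γ

inΓ : Ctx → Res → Bool
inΓ Γ r = any (λ e → name e ≡ᵇ r) Γ

-- Resource configurations (O,L,D): each resource is in at most one of O,L,D

data Status : Set where
  none inO inL inD : Status

RConf : Set
RConf = Res → Status

_[_≔ᵣ_] : RConf → Res → Status → RConf
(ρ [ r ≔ᵣ st ]) r' = if r' ≡ᵇ r then st else ρ r'

isD : Status → Bool
isD inD = true
isD _ = false

data IsLD : Status → Set where
  isL : IsLD inL
  isD' : IsLD inD

-- (∅, ∅, Res(Γ))
ρ₀ : Ctx → RConf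
ρ₀ Γ r = if inΓ Γ r then inD else none

invD : Ctx → RConf → Assn
invD Γ ρ = foldr (λ e acc → if isD (ρ (name e)) then rinv e ⋆ acc else acc) emp Γ

PV-LD : Ctx → RConf → Var → Set
PV-LD [] ρ x = ⊥
PV-LD (e ∷ Γ) ρ x = (IsLD (ρ (name e)) × pv e x) ⊎ PV-LD Γ ρ x

data Basic : Set where
  assign  : Var → Exp → Basic
  load    : Var → Exp → Basic
  store   : Exp → Exp → Basic
  cons    : Var → List Exp → Basic
  dispose : Exp → Basic

data Cmd : Set where
  skip      : Cmd
  bc        : Basic → Cmd
  _︔_       : Cmd → Cmd → Cmd
  ifc       : BExp → Cmd → Cmd → Cmd
  whilec    : BExp → Cmd → Cmd
  resourcec : Res → Cmd → Cmd
  withc     : Res → BExp → Cmd → Cmd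
  _∥_       : Cmd → Cmd → Cmd
  withinc   : Res → Cmd → Cmd

locked : Cmd → Res → Bool
locked (C₁ ︔ C₂) r = locked C₁ r
locked (C₁ ∥ C₂) r = locked C₁ r ∨ locked C₂ r
locked (resourcec r' C) r = not (r ≡ᵇ r') ∧ locked C r
locked (withinc r' C) r = (r ≡ᵇ r') ∨ locked C r
locked _ r = false

-- chng(C): variables possibly assigned by the next transition of C
chng : Cmd → Var → Set
chng (bc (assign x e)) y = y ≡ x
chng (bc (load x e)) y = y ≡ x
chng (bc (cons x es)) y = y ≡ x
chng (C₁ ︔ C₂) y = chng C₁ y
chng (C₁ ∥ C₂) y = chng C₁ y ⊎ chng C₂ y
chng (resourcec r C) y = chng C y
chng (withinc r C) y = chng C y
chng _ y = ⊥

PV-Locked : Ctx → Cmd → Var → Set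
PV-Locked [] C x = ⊥
PV-Locked (e ∷ Γ) C x = (locked C (name e) ≡ true × pv e x) ⊎ PV-Locked Γ C x

InDom : Store → Heap → Exp → Set
InDom s h e = Σ Loc λ l → Σ Val λ v → ⟦ e ⟧ₑ s ≡ int (ℤ.+ l) × fun h l ≡ just v

Fresh : Heap → Loc → List Val → Set
Fresh h l [] = ⊤
Fresh h l (v ∷ vs) = fun h l ≡ nothing × Fresh h (suc l) vs

alloc : Loc → List Val → (Loc → Maybe Val) → Loc → Maybe Val
alloc l [] f l' = f l'
alloc l (v ∷ vs) f l' = if l' ≡ᵇ l then just v else alloc (suc l) vs f l'

data BSem : Basic → Store → Heap → Store → Heap → Set where
  b-assign : ∀ {x e s h} → BSem (assign x e) s h (s [ x ≔ ⟦ e ⟧ₑ s ]) h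
  b-load : ∀ {x e s h l v} → ⟦ e ⟧ₑ s ≡ int (ℤ.+ l) → fun h l ≡ just v →
           BSem (load x e) s h (s [ x ≔ v ]) h
  b-store : ∀ {e e' s h l v} (h' : Heap) → ⟦ e ⟧ₑ s ≡ int (ℤ.+ l) → fun h l ≡ just v →
            (∀ l' → fun h' l' ≡ (if l' ≡ᵇ l then just (⟦ e' ⟧ₑ s) else fun h l')) →
            BSem (store e e') s h s h'
  b-cons : ∀ {x es s h} (l : Loc) (h' : Heap) →
           Fresh h l (map (λ e → ⟦ e ⟧ₑ s) es) →
           (∀ l' → fun h' l' ≡ alloc l (map (λ e → ⟦ e ⟧ₑ s) es) (fun h) l') →
           BSem (cons x es) s h (s [ x ≔ int (ℤ.+ l) ]) h'
  b-dispose : ∀ {e s h l v} (h' : Heap) → ⟦ e ⟧ₑ s ≡ int (ℤ.+ l) → fun h l ≡ just v →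
              (∀ l' → fun h' l' ≡ (if l' ≡ᵇ l then nothing else fun h l')) →
              BSem (dispose e) s h s h'

data BFault : Basic → Store → Heap → Set where
  f-load    : ∀ {x e s h} → ¬ InDom s h e → BFault (load x e) s h
  f-store   : ∀ {e e' s h} → ¬ InDom s h e → BFault (store e e') s h
  f-dispose : ∀ {e s h} → ¬ InDom s h e → BFault (dispose e) s h

State : Set
State = Store × Heap × RConf

data Step : Cmd → State → Cmd → State → Set where
  S1 : ∀ {C₂ σ} → Step (skip ︔ C₂) σ C₂ σ
  S2 : ∀ {C₁ C₁' C₂ σ σ'} → Step C₁ σ C₁' σ' → Step (C₁ ︔ C₂) σ (C₁' ︔ C₂) σ'
  LP : ∀ {B C σ} → Step (whilec B C) σ (ifc B (C ︔ whilec B C) skip) σ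
  IF1 : ∀ {B C₁ C₂ s h ρ} → ⟦ B ⟧ᵇ s ≡ true → Step (ifc B C₁ C₂) (s , h , ρ) C₁ (s , h , ρ)
  IF2 : ∀ {B C₁ C₂ s h ρ} → ⟦ B ⟧ᵇ s ≡ false → Step (ifc B C₁ C₂) (s , h , ρ) C₂ (s , h , ρ)
  P1 : ∀ {C₁ C₁' C₂ σ σ'} → Step C₁ σ C₁' σ' → Step (C₁ ∥ C₂) σ (C₁' ∥ C₂) σ'
  P2 : ∀ {C₁ C₂ C₂' σ σ'} → Step C₂ σ C₂' σ' → Step (C₁ ∥ C₂) σ (C₁ ∥ C₂') σ'
  P3 : ∀ {σ} → Step (skip ∥ skip) σ skip σ
  R0 : ∀ {r s h ρ} → ρ r ≡ none → Step (resourcec r skip) (s , h , ρ) skip (s , h , ρ)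
  R1 : ∀ {r C C' s h ρ s' h' ρ'} → ρ r ≡ none → locked C r ≡ true →
       Step C (s , h , ρ [ r ≔ᵣ inO ]) C' (s' , h' , ρ') →
       Step (resourcec r C) (s , h , ρ) (resourcec r C') (s' , h' , ρ' [ r ≔ᵣ none ])
  R2 : ∀ {r C C' s h ρ s' h' ρ'} → ρ r ≡ none → locked C r ≡ false →
       Step C (s , h , ρ [ r ≔ᵣ inD ]) C' (s' , h' , ρ') →
       Step (resourcec r C) (s , h , ρ) (resourcec r C') (s' , h' , ρ' [ r ≔ᵣ none ])
  W0 : ∀ {r B C s h ρ} → ρ r ≡ inD → ⟦ B ⟧ᵇ s ≡ true →
       Step (withc r B C) (s , h , ρ) (withinc r C) (s , h , ρ [ r ≔ᵣ inO ])
  W1 : ∀ {r C C' s h ρ s' h' ρ'} → ρ r ≡ inO →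
       Step C (s , h , ρ [ r ≔ᵣ none ]) C' (s' , h' , ρ') →
       Step (withinc r C) (s , h , ρ) (withinc r C') (s' , h' , ρ' [ r ≔ᵣ inO ])
  W2 : ∀ {r s h ρ} → ρ r ≡ inO →
       Step (withinc r skip) (s , h , ρ) skip (s , h , ρ [ r ≔ᵣ inD ])
  BCT : ∀ {c s h ρ s' h'} → BSem c s h s' h' → Step (bc c) (s , h , ρ) skip (s' , h' , ρ)

data Abort : Cmd → State → Set where
  A-res : ∀ {r C s h ρ} → ρ r ≢ none → Abort (resourcec r C) (s , h , ρ)
  A-with : ∀ {r B C s h ρ} → ρ r ≡ none → Abort (withc r B C) (s , h , ρ)
  A-within : ∀ {r C s h ρ} → ρ r ≢ inO → Abort (withinc r C) (s , h , ρ)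
  A-basic : ∀ {c s h ρ} → BFault c s h → Abort (bc c) (s , h , ρ)
  A-seq : ∀ {C₁ C₂ σ} → Abort C₁ σ → Abort (C₁ ︔ C₂) σ
  A-par1 : ∀ {C₁ C₂ σ} → Abort C₁ σ → Abort (C₁ ∥ C₂) σ
  A-par2 : ∀ {C₁ C₂ σ} → Abort C₂ σ → Abort (C₁ ∥ C₂) σ
  RA1 : ∀ {r C s h ρ} → ρ r ≡ none → locked C r ≡ true →
        Abort C (s , h , ρ [ r ≔ᵣ inO ]) → Abort (resourcec r C) (s , h , ρ)
  RA2 : ∀ {r C s h ρ} → ρ r ≡ none → locked C r ≡ false →
        Abort C (s , h , ρ [ r ≔ᵣ inD ]) → Abort (resourcec r C) (s , h , ρ)
  A-within' : ∀ {r C s h ρ} → Abort C (s , h , ρ [ r ≔ᵣ none ]) →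
              Abort (withinc r C) (s , h , ρ)

data Outcome : Set where
  cfg   : Cmd → State → Outcome
  abort : Outcome

data Steps : ℕ → Cmd → State → Outcome → Set where
  done : ∀ {C σ} → Steps zero C σ (cfg C σ)
  step : ∀ {k C σ C' σ' o} → Step C σ C' σ' → Steps k C' σ' o → Steps (suc k) C σ o
  ab   : ∀ {C σ} → Abort C σ → Steps (suc zero) C σ abort

Valid : Ctx → Assn → Cmd → Assn → Set
Valid Γ P C Q =
  ∀ s h → s , h ⊨ (P ⋆ inv Γ) →
    (∀ k → ¬ Steps k C (s , h , ρ₀ Γ) abort)
  × (∀ k s' h' ρ' → Steps k C (s , h , ρ₀ Γ) (cfg skip (s' , h' , ρ')) →
       (∀ r → ρ' r ≡ ρ₀ Γ r) → s' , h' ⊨ (Q ⋆ inv Γ))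

-- (O,L,D) ↝ (O,L',D') with L' ∪ D' = L ∪ D
data Compat : Status → Status → Set where
  c-none : Compat none none
  c-O    : Compat inO inO
  c-LD   : ∀ {st st'} → IsLD st → IsLD st' → Compat st st'

data EnvStep (A : Var → Set) (Γ : Ctx) : Cmd → State → Cmd → State → Set where
  env : ∀ {C s s' h hG hG' H H' ρ ρ'} →
        (∀ x → (A x ⊎ PV-Locked Γ C x) → s x ≡ s' x) →
        (∀ r → Compat (ρ r) (ρ' r)) →
        s , hG ⊨ invD Γ ρ → s' , hG' ⊨ invD Γ ρ' →
        Sep h hG H → Sep h hG' H' →
        EnvStep A Γ C (s , H , ρ) C (s' , H' , ρ')

Trans : (Var → Set) → Ctx → Cmd → State → Cmd → State → Set
Trans A Γ C σ C' σ' = Step C σ C' σ' ⊎ EnvStep A Γ C σ C' σ'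

Safe : ℕ → Cmd → Store → Heap → RConf → Ctx → Assn → (Var → Set) → Set
Safe zero C s h ρ Γ Q A = ⊤
Safe (suc n) C s h ρ Γ Q A =
    (C ≡ skip → s , h ⊨ Q)
  × ¬ Abort C (s , h , ρ)
  × (∀ x → chng C x → ¬ PV-LD Γ ρ x)
  × (∀ hG H → Sep h hG H → s , hG ⊨ invD Γ ρ →
       ∀ C' s' Ĥ ρ' → Trans A Γ C (s , H , ρ) C' (s' , Ĥ , ρ') →
       Σ Heap λ h' → Σ Heap λ hG' → Sep h' hG' Ĥ × (s' , hG' ⊨ invD Γ ρ')
         × Safe n C' s' h' ρ' Γ Q A)

module Submission where

open import Defs
open import Data.Nat using (ℕ; zero; suc; _+_; _≡ᵇ_)
open import Data.Nat.Properties using (≡⇒≡ᵇ)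
open import Data.Bool using (true; if_then_else_)
open import Data.List using ([]; _∷_)
open import Data.Bool.Properties using (T-≡)
open import Data.List.Relation.Unary.All as All using (All)
open import Data.List.Relation.Unary.Any as Any using ()
open import Data.List.Relation.Unary.Any.Properties using (any⁺)
open import Data.List.Membership.Propositional using (_∈_)
open import Data.Product using (Σ; _×_; _,_; proj₁)
open import Data.Sum using (inj₁; inj₂)
open import Function using (Equivalence)
open import Relation.Nullary using (¬_)
open import Relation.Binary.PropositionalEquality

-- Safety is an invariant of program steps: clause (iv) applied to a program
-- transition re-splits the global heap into a local part, still safe one level
-- lower, and a part satisfying the invariants of the resources in D. Following a
-- run of k steps from a state safe for k + 1 levels therefore never meets an
-- abort (a fault in the global heap is already a fault in the local part) and, on
-- reaching skip with every resource back in D, yields Q for the local part and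
-- inv Γ for the rest.

Sep⇒⊑ : ∀ h hG H → Sep h hG H → h ⊑ H
Sep⇒⊑ h hG H sep l v h[l]≡v with sep l
... | inj₁ (h[l]≡nothing , _) with () ← trans (sym h[l]≡v) h[l]≡nothing
... | inj₂ (_ , H[l]≡h[l])   = trans H[l]≡h[l] h[l]≡v

BFault-antimono : ∀ {s h H} → h ⊑ H → ∀ {c} → BFault c s H → BFault c s h
BFault-antimono {s} {h} {H} h⊑H = restrictFault
  where
  restrict : ∀ e → ¬ InDom s H e → ¬ InDom s h e
  restrict e ∉H (l , v , e≡l , h[l]≡v) = ∉H (l , v , e≡l , h⊑H l v h[l]≡v)

  restrictFault : ∀ {c} → BFault c s H → BFault c s h
  restrictFault (f-load {e = e} ∉H)    = f-load (restrict e ∉H)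
  restrictFault (f-store {e = e} ∉H)   = f-store (restrict e ∉H)
  restrictFault (f-dispose {e = e} ∉H) = f-dispose (restrict e ∉H)

Abort-antimono : ∀ {C s h H ρ} → h ⊑ H → Abort C (s , H , ρ) → Abort C (s , h , ρ)
Abort-antimono h⊑H (A-res r∈ρ)     = A-res r∈ρ
Abort-antimono h⊑H (A-with r∉ρ)    = A-with r∉ρ
Abort-antimono h⊑H (A-within r∉O)  = A-within r∉O
Abort-antimono h⊑H (A-basic fault) = A-basic (BFault-antimono h⊑H fault)
Abort-antimono h⊑H (A-seq a)       = A-seq (Abort-antimono h⊑H a)
Abort-antimono h⊑H (A-par1 a)      = A-par1 (Abort-antimono h⊑H a)
Abort-antimono h⊑H (A-par2 a)      = A-par2 (Abort-antimono h⊑H a)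
Abort-antimono h⊑H (RA1 r∉ρ lk a)  = RA1 r∉ρ lk (Abort-antimono h⊑H a)
Abort-antimono h⊑H (RA2 r∉ρ lk a)  = RA2 r∉ρ lk (Abort-antimono h⊑H a)
Abort-antimono h⊑H (A-within' a)   = A-within' (Abort-antimono h⊑H a)

SafeConfig : ℕ → Ctx → Assn → (Var → Set) → Cmd → State → Set
SafeConfig n Γ Q A C (s , H , ρ) =
  Σ Heap λ h → Σ Heap λ hG → Sep h hG H × (s , hG ⊨ invD Γ ρ) × Safe n C s h ρ Γ Q A

module _ {Γ : Ctx} {Q : Assn} {A : Var → Set} where

  SafeConfig-¬Abort : ∀ {n C σ} → SafeConfig (suc n) Γ Q A C σ → ¬ Abort C σ
  SafeConfig-¬Abort {σ = _ , H , _} (h , hG , sep , _ , _ , ¬abort , _) a =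
    ¬abort (Abort-antimono (Sep⇒⊑ h hG H sep) a)

  SafeConfig-step : ∀ {n C σ C' σ'} → SafeConfig (suc n) Γ Q A C σ → Step C σ C' σ' →
                    SafeConfig n Γ Q A C' σ'
  SafeConfig-step (h , hG , sep , hG⊨ , _ , _ , _ , next) st =
    next hG _ sep hG⊨ _ _ _ _ (inj₁ st)

  SafeConfig-steps : ∀ k {n C σ C' σ'} → SafeConfig (k + n) Γ Q A C σ →
                     Steps k C σ (cfg C' σ') → SafeConfig n Γ Q A C' σ'
  SafeConfig-steps zero    safe done            = safe
  SafeConfig-steps (suc k) safe (step st steps) =
    SafeConfig-steps k (SafeConfig-step safe st) steps

  SafeConfig-¬Steps-abort : ∀ k {C σ} → SafeConfig (suc k) Γ Q A C σ → ¬ Steps k C σ abort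
  SafeConfig-¬Steps-abort (suc k) safe (step st steps) =
    SafeConfig-¬Steps-abort k (SafeConfig-step safe st) steps
  SafeConfig-¬Steps-abort (suc zero) safe (ab a) = SafeConfig-¬Abort safe a

invD-cong : ∀ Γ {ρ ρ'} → (∀ r → ρ r ≡ ρ' r) → invD Γ ρ ≡ invD Γ ρ'
invD-cong []      ρ≗ρ' = refl
invD-cong (e ∷ Γ) ρ≗ρ' rewrite ρ≗ρ' (name e) | invD-cong Γ ρ≗ρ' = refl

invD-allD : ∀ Γ {ρ} → All (λ e → ρ (name e) ≡ inD) Γ → invD Γ ρ ≡ inv Γ
invD-allD []      All.[]         = refl
invD-allD (e ∷ Γ) (e∈D All.∷ Γ⊆D) rewrite e∈D | invD-allD Γ Γ⊆D = refl

inΓ-name : ∀ Γ {e} → e ∈ Γ → inΓ Γ (name e) ≡ true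
inΓ-name Γ {e} e∈Γ = Equivalence.to T-≡
  (any⁺ (λ e' → name e' ≡ᵇ name e) (Any.map (λ { refl → ≡⇒≡ᵇ (name e) _ refl }) e∈Γ))

invD-ρ₀ : ∀ Γ → invD Γ (ρ₀ Γ) ≡ inv Γ
invD-ρ₀ Γ = invD-allD Γ (All.tabulate λ e∈Γ → cong (if_then inD else none) (inΓ-name Γ e∈Γ))

theorem1 : (C : Cmd) (P Q : Assn) (Γ : Ctx) (A : Var → Set) → WFCtx Γ →
    (∀ s h → s , h ⊨ P → ∀ (n : ℕ) → Safe n C s h (ρ₀ Γ) Γ Q A) →
    Valid Γ P C Q
theorem1 C P Q Γ A _ safe s h (h₁ , h₂ , sep , h₁⊨P , h₂⊨inv) =
  (λ k → SafeConfig-¬Steps-abort k (initial (suc k)))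
  , λ k s' h' ρ' steps ρ'≗ρ₀ →
      let (h₁' , h₂' , sep' , h₂'⊨invD , safe₁) = SafeConfig-steps k (initial (k + 1)) steps
      in  h₁' , h₂' , sep' , proj₁ safe₁ refl
          , subst (s' , h₂' ⊨_) (trans (invD-cong Γ ρ'≗ρ₀) (invD-ρ₀ Γ)) h₂'⊨invD
  where
  initial : ∀ n → SafeConfig n Γ Q A C (s , h , ρ₀ Γ)
  initial n = h₁ , h₂ , sep , subst (s , h₂ ⊨_) (sym (invD-ρ₀ Γ)) h₂⊨inv , safe s h₁ h₁⊨P n
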